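{- Let $\mathcal D_1'$ be the set of discriminant forms $D$ which are orthogonal sums of Jordan components of type $2_{I\!I}^{\pm n}$, $2_t^{\pm n}$ and $4_s^{\pm m}$ and which contain no non-trivial isotropic elements. Then $\mathcal D_1'$ consists (up to isomorphism) exactly of: $\{0\}$, $2_{I\!I}^{ -2}$, $2_t^{\pm1}$; $2_t^{\pm2}$ with $t\equiv2\bmod4$; $2_t^{\epsilon3}$ with $\epsilon\left(\frac{t}{2}\right)=-1$; $4_t^{\pm1}$; $2_t^{\pm1}4_s^{\pm1}$.
   Context: A discriminant form is a finite abelian group $D$ with a quadratic form $\operatorname{q}:D\to\mathbb Q/\mathbb Z$ whose bilinear form is non-degenerate; $\gamma$ is isotropic if $\operatorname{q}(\gamma)=0\bmod1$. 2-adic Jordan components in Conway–Sloane notation: $q_{I\!I}^{\pm2n}$ is an even component isomorphic to $(\mathbb Z/q\mathbb Z)^{2n}$ of level $q$; $q_t^{\pm n}$ is an odd component isomorphic to $(\mathbb Z/q\mathbb Z)^n$ of level $2q$, with oddity $t\in\mathbb Z/8\mathbb Z$. $\left(\frac{t}{2}\right)$ is the Kronecker symbol. -}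

module Defs where

open import Data.Nat using (ℕ; zero; suc; _+_; _*_; _%_)
open import Data.Nat.DivMod using (_mod_)
open import Data.Fin using (Fin; toℕ)
open import Data.Product using (_×_; _,_; Σ; ∃; proj₁; proj₂)
open import Data.Unit using (⊤; tt)
open import Data.List using (List; []; _∷_; _++_; replicate; map; sum; foldr)
open import Data.List.Relation.Unary.All using (All)
open import Data.Sign using (Sign) renaming (_*_ to _*ₛ_)
open import Relation.Binary.PropositionalEquality using (_≡_)

-- Every such form takes values in (1/8)ℤ/ℤ ⊂ ℚ/ℤ, so a value v/8 mod 1
-- is represented by its numerator v : ℕ, compared modulo 8.
--
-- Elementary orthogonal summands (Conway–Sloane):
--   hyp    : (ℤ/2)², q(x,y) = xy/2              (the plane u, 2_II^{+2})
--   ell    : (ℤ/2)², q(x,y) = (x²+xy+y²)/2      (the plane v, 2_II^{-2})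
--   odd2 a : ℤ/2,    q(x)   = a x²/4   (a odd)  (rank one part of 2_t^{±n})
--   odd4 a : ℤ/4,    q(x)   = a x²/8   (a odd)  (rank one part of 4_t^{±n})

data Block : Set where
  hyp  : Block
  ell  : Block
  odd2 : ℕ → Block
  odd4 : ℕ → Block

El : Block → Set
El hyp      = Fin 2 × Fin 2
El ell      = Fin 2 × Fin 2
El (odd2 a) = Fin 2
El (odd4 a) = Fin 4

addF : ∀ n → Fin (suc n) → Fin (suc n) → Fin (suc n)
addF n i j = (toℕ i + toℕ j) mod (suc n)

addEl : (b : Block) → El b → El b → El b
addEl hyp      (x , y) (x' , y') = addF 1 x x' , addF 1 y y'
addEl ell      (x , y) (x' , y') = addF 1 x x' , addF 1 y y'
addEl (odd2 a) x x' = addF 1 x x'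
addEl (odd4 a) x x' = addF 3 x x'

zeroEl : (b : Block) → El b
zeroEl hyp      = Fin.zero , Fin.zero
zeroEl ell      = Fin.zero , Fin.zero
zeroEl (odd2 a) = Fin.zero
zeroEl (odd4 a) = Fin.zero

-- numerator (over 8) of the quadratic form on a block
qEl : (b : Block) → El b → ℕ
qEl hyp      (x , y) = 4 * (toℕ x * toℕ y)
qEl ell      (x , y) = 4 * (toℕ x * toℕ x + toℕ x * toℕ y + toℕ y * toℕ y)
qEl (odd2 a) x = 2 * a * (toℕ x * toℕ x)
qEl (odd4 a) x = a * (toℕ x * toℕ x)

Elt : List Block → Set
Elt []       = ⊤
Elt (b ∷ bs) = El b × Elt bs

add : (bs : List Block) → Elt bs → Elt bs → Elt bs
add []       x        y        = tt
add (b ∷ bs) (x , xs) (y , ys) = addEl b x y , add bs xs ys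

zeroE : (bs : List Block) → Elt bs
zeroE []       = tt
zeroE (b ∷ bs) = zeroEl b , zeroE bs

Q : (bs : List Block) → Elt bs → ℕ
Q []       tt       = 0
Q (b ∷ bs) (x , xs) = qEl b x + Q bs xs

Anisotropic : List Block → Set
Anisotropic bs = ∀ (x : Elt bs) → Q bs x % 8 ≡ 0 → x ≡ zeroE bs

record _≅_ (bs cs : List Block) : Set where
  field
    to      : Elt bs → Elt cs
    from    : Elt cs → Elt bs
    from-to : ∀ x → from (to x) ≡ x
    to-from : ∀ y → to (from y) ≡ y
    to-add  : ∀ x y → to (add bs x y) ≡ add cs (to x) (to y)
    to-q    : ∀ x → Q cs (to x) % 8 ≡ Q bs x % 8

Odd : ℕ → Set
Odd a = a % 2 ≡ 1

kron : ℕ → Sign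
kron a with a % 8
... | 1 = Sign.+
... | 7 = Sign.+
... | _ = Sign.-

signProd : List ℕ → Sign
signProd = foldr (λ a s → kron a *ₛ s) Sign.+

-- The form  2_II^{(−1)^l · 2(k+l)} ⊕ 2_t^{ε n} ⊕ 4_s^{δ m}, where the odd
-- components are given by diagonalisations  as = (a₁,…,aₙ), cs = (c₁,…,cₘ)
-- (all entries odd); then t ≡ Σ aᵢ, ε = ∏ (2/aᵢ), s ≡ Σ cⱼ, δ = ∏ (2/cⱼ).
formOf : ℕ → ℕ → List ℕ → List ℕ → List Block
formOf k l as cs = replicate k hyp ++ replicate l ell ++ map odd2 as ++ map odd4 cs

data Listed : List Block → Set where
  trivial : Listed (formOf 0 0 [] [])
  evenMinus : Listed (formOf 0 1 [] [])
  two1 : ∀ a → Odd a → Listed (formOf 0 0 (a ∷ []) [])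
  two2 : ∀ a₁ a₂ → Odd a₁ → Odd a₂ → (a₁ + a₂) % 4 ≡ 2 →
         Listed (formOf 0 0 (a₁ ∷ a₂ ∷ []) [])
  two3 : ∀ a₁ a₂ a₃ → Odd a₁ → Odd a₂ → Odd a₃ →
         signProd (a₁ ∷ a₂ ∷ a₃ ∷ []) *ₛ kron (a₁ + a₂ + a₃) ≡ Sign.- →
         Listed (formOf 0 0 (a₁ ∷ a₂ ∷ a₃ ∷ []) [])
  four1 : ∀ c → Odd c → Listed (formOf 0 0 [] (c ∷ []))
  two1four1 : ∀ a c → Odd a → Odd c → Listed (formOf 0 0 (a ∷ []) (c ∷ []))

InList : List Block → Set
InList bs = Σ (List Block) (λ cs → Listed cs × (bs ≅ cs))

-- Every form in question takes values in (1/8)ℤ/ℤ, and its isomorphism class depends on the odd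
-- diagonal entries only through their residues mod 8.  An orthogonal summand of an anisotropic form
-- is anisotropic, and the forms 2_II^{+2}, 2_II^{-2} 2_II^{-2}, 2_II^{-2} 4_c, 2_II^{-2} 2_a 2_b,
-- 4_c 4_d, 2_a 2_b 4_c and 2_a 2_b 2_c 2_d are all isotropic; what survives has at most three odd
-- components, and for these anisotropy is decided by exhausting the finitely many elements for each
-- choice of residues 1, 3, 5, 7.  The one survivor not literally on the list, 2_II^{-2} 2_a, is
-- isomorphic to 2_{3a}^3.
module Submission where

open import Defs
open import Data.Nat using (ℕ)
open import Data.List using (List)
open import Data.List.Relation.Unary.All using (All)
open import Data.Product using (_×_)

open import Data.Nat using (zero; suc; _+_; _*_; _%_)
open import Data.Nat.Properties using (*-zeroʳ; +-identityʳ; +-assoc) renaming (_≟_ to _≟ℕ_)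
open import Data.Nat.DivMod using (_mod_; %-distribˡ-+; %-distribˡ-*; m%n%n≡m%n; m%n<n; m∣n⇒o%n%m≡o%m)
open import Data.Nat.Divisibility using (divides-refl)
open import Data.Nat.ListAction using (sum)
open import Data.Fin using (Fin; toℕ)
open import Data.Fin.Patterns using (0F; 1F; 2F; 3F; 4F; 5F; 6F; 7F)
open import Data.Fin.Properties using (all?; toℕ-fromℕ<) renaming (_≟_ to _≟ᶠ_)
open import Data.Vec using (Vec; []; _∷_; toList) renaming (map to mapᵛ)
open import Data.Product using (_,_; ∃; proj₁; proj₂; map₂; curry; uncurry)
open import Data.Product.Properties using (≡-dec)
open import Data.Unit using (⊤; tt)
open import Data.Unit.Properties using () renaming (_≟_ to _≟ᵘ_)
open import Data.Empty using (⊥-elim)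
open import Data.List using ([]; _∷_; map; length; replicate)
open import Data.List.Relation.Unary.All using ([]; _∷_)
open import Data.List.Relation.Binary.Pointwise using (Pointwise; []; _∷_; ++⁺; map⁺)
import Data.List.Relation.Binary.Pointwise as Pointwise
open import Data.List.Relation.Binary.Sublist.Propositional using (_⊆_; []; _∷_; _∷ʳ_; minimum)
open import Data.List.Relation.Binary.Sublist.Propositional.Properties using (++⁺ˡ)
open import Data.Sign using (Sign) renaming (_*_ to _*ₛ_)
open import Data.Sign.Properties using () renaming (_≟_ to _≟ˢ_)
open import Function.Bundles using (_⇔_; mk⇔; Equivalence)
open import Function.Properties.Equivalence using () renaming (trans to ⇔-trans)
open import Level using (0ℓ)
open import Relation.Nullary using (Dec; ¬?)
open import Relation.Nullary.Decidable using (map′; _→-dec_; _×-dec_; True; toWitness)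
open import Relation.Unary using (Pred; Decidable)
open import Relation.Binary.Definitions using (DecidableEquality)
open import Relation.Binary.PropositionalEquality

open _≅_
open Equivalence using (to; from)

private variable
  a a' b b' : ℕ
  as as' cs cs' : List ℕ
  bs bs' bs'' : List Block

infix 4 _≡₈_

record _≡₈_ (m n : ℕ) : Set where
  constructor mod8
  field ≡-mod8 : m % 8 ≡ n % 8

open _≡₈_

≡₈-refl : ∀ n → n ≡₈ n
≡₈-refl n = mod8 refl

≡₈-sym : a ≡₈ b → b ≡₈ a
≡₈-sym (mod8 e) = mod8 (sym e)

≡₈-trans : a ≡₈ a' → a' ≡₈ b → a ≡₈ b
≡₈-trans (mod8 e) (mod8 f) = mod8 (trans e f)

+-cong₈ : a ≡₈ a' → b ≡₈ b' → a + b ≡₈ a' + b'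
+-cong₈ {a} {a'} {b} {b'} (mod8 e) (mod8 f) = mod8 (begin
  (a + b) % 8              ≡⟨ %-distribˡ-+ a b 8 ⟩
  (a % 8 + b % 8) % 8      ≡⟨ cong₂ (λ u v → (u + v) % 8) e f ⟩
  (a' % 8 + b' % 8) % 8    ≡⟨ %-distribˡ-+ a' b' 8 ⟨
  (a' + b') % 8            ∎)
  where open ≡-Reasoning

*-cong₈ : a ≡₈ a' → b ≡₈ b' → a * b ≡₈ a' * b'
*-cong₈ {a} {a'} {b} {b'} (mod8 e) (mod8 f) = mod8 (begin
  (a * b) % 8              ≡⟨ %-distribˡ-* a b 8 ⟩
  (a % 8 * (b % 8)) % 8    ≡⟨ cong₂ (λ u v → (u * v) % 8) e f ⟩
  (a' % 8 * (b' % 8)) % 8  ≡⟨ %-distribˡ-* a' b' 8 ⟨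
  (a' * b') % 8            ∎)
  where open ≡-Reasoning

≡₈⇒≡₄ : a ≡₈ b → a % 4 ≡ b % 4
≡₈⇒≡₄ {a} {b} (mod8 e) = begin
  a % 4      ≡⟨ m∣n⇒o%n%m≡o%m 4 8 a (divides-refl 2) ⟨
  a % 8 % 4  ≡⟨ cong (_% 4) e ⟩
  b % 8 % 4  ≡⟨ m∣n⇒o%n%m≡o%m 4 8 b (divides-refl 2) ⟩
  b % 4      ∎
  where open ≡-Reasoning

sum-cong₈ : Pointwise _≡₈_ as as' → sum as ≡₈ sum as'
sum-cong₈ []       = mod8 refl
sum-cong₈ (e ∷ es) = +-cong₈ e (sum-cong₈ es)

kron-cong : a ≡₈ b → kron a ≡ kron b
kron-cong {a} {b} (mod8 e) with a % 8 | b % 8 | e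
... | _ | _ | refl = refl

signProd-cong : Pointwise _≡₈_ as as' → signProd as ≡ signProd as'
signProd-cong []       = refl
signProd-cong (e ∷ es) = cong₂ _*ₛ_ (kron-cong e) (signProd-cong es)

*-odd : ∀ a b → Odd a → Odd b → Odd (a * b)
*-odd a b oa ob = trans (%-distribˡ-* a b 2) (cong₂ (λ u v → (u * v) % 2) oa ob)

qEl-zero : ∀ b → qEl b (zeroEl b) ≡ 0
qEl-zero hyp      = refl
qEl-zero ell      = refl
qEl-zero (odd2 a) = *-zeroʳ (2 * a)
qEl-zero (odd4 a) = *-zeroʳ a

Q-zero : ∀ bs → Q bs (zeroE bs) ≡ 0
Q-zero []       = refl
Q-zero (b ∷ bs) = cong₂ _+_ (qEl-zero b) (Q-zero bs)

≅-refl : bs ≅ bs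
≅-refl = record
  { to = λ x → x ; from = λ x → x ; from-to = λ _ → refl ; to-from = λ _ → refl
  ; to-add = λ _ _ → refl ; to-q = λ _ → refl }

≅-sym : bs ≅ bs' → bs' ≅ bs
≅-sym {bs} {bs'} i = record
  { to = from i ; from = to i ; from-to = to-from i ; to-from = from-to i
  ; to-add = from-add
  ; to-q = λ y → trans (sym (to-q i (from i y))) (cong (λ z → Q bs' z % 8) (to-from i y)) }
  where
  open ≡-Reasoning
  from-add : ∀ y y' → from i (add bs' y y') ≡ add bs (from i y) (from i y')
  from-add y y' = begin
    from i (add bs' y y')                                ≡⟨ cong₂ (λ u v → from i (add bs' u v)) (to-from i y) (to-from i y') ⟨
    from i (add bs' (to i (from i y)) (to i (from i y'))) ≡⟨ cong (from i) (to-add i (from i y) (from i y')) ⟨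
    from i (to i (add bs (from i y) (from i y')))         ≡⟨ from-to i _ ⟩
    add bs (from i y) (from i y')                         ∎

≅-trans : bs ≅ bs' → bs' ≅ bs'' → bs ≅ bs''
≅-trans i j = record
  { to = λ x → to j (to i x) ; from = λ z → from i (from j z)
  ; from-to = λ x → trans (cong (from i) (from-to j (to i x))) (from-to i x)
  ; to-from = λ z → trans (cong (to j) (to-from i (from j z))) (to-from j z)
  ; to-add = λ x y → trans (cong (to j) (to-add i x y)) (to-add j (to i x) (to i y))
  ; to-q = λ x → trans (to-q j (to i x)) (to-q i x) }

≅-∷ : ∀ {b c} → (b ∷ []) ≅ (c ∷ []) → bs ≅ bs' → (b ∷ bs) ≅ (c ∷ bs')
≅-∷ {bs} {bs'} {b} {c} i j = record
  { to = λ (x , xs) → proj₁ (to i (x , tt)) , to j xs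
  ; from = λ (y , ys) → proj₁ (from i (y , tt)) , from j ys
  ; from-to = λ (x , xs) → cong₂ _,_ (cong proj₁ (from-to i (x , tt))) (from-to j xs)
  ; to-from = λ (y , ys) → cong₂ _,_ (cong proj₁ (to-from i (y , tt))) (to-from j ys)
  ; to-add = λ (x , xs) (y , ys) → cong₂ _,_ (cong proj₁ (to-add i (x , tt) (y , tt))) (to-add j xs ys)
  ; to-q = λ (x , xs) → ≡-mod8 (+-cong₈ (head-q x) (mod8 (to-q j xs))) }
  where
  head-q : ∀ x → qEl c (proj₁ (to i (x , tt))) ≡₈ qEl b x
  head-q x = mod8 (subst₂ (λ u v → u % 8 ≡ v % 8) (+-identityʳ (qEl c _)) (+-identityʳ (qEl b x)) (to-q i (x , tt)))

≅⇒Anisotropic : bs ≅ bs' → Anisotropic bs' → Anisotropic bs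
≅⇒Anisotropic {bs} {bs'} i an x x-isotropic = begin
  x                        ≡⟨ from-to i x ⟨
  from i (to i x)          ≡⟨ cong (from i) (an (to i x) (trans (to-q i x) x-isotropic)) ⟩
  from i (zeroE bs')       ≡⟨ cong (from i) (an (to i (zeroE bs)) (trans (to-q i _) (cong (_% 8) (Q-zero bs)))) ⟨
  from i (to i (zeroE bs)) ≡⟨ from-to i _ ⟩
  zeroE bs                 ∎
  where open ≡-Reasoning

≅⇒Anisotropic⇔ : bs ≅ bs' → Anisotropic bs ⇔ Anisotropic bs'
≅⇒Anisotropic⇔ i = mk⇔ (≅⇒Anisotropic (≅-sym i)) (≅⇒Anisotropic i)

infix 4 _≈ᵇ_

data _≈ᵇ_ : Block → Block → Set where
  hyp  : hyp ≈ᵇ hyp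
  ell  : ell ≈ᵇ ell
  odd2 : a ≡₈ a' → odd2 a ≈ᵇ odd2 a'
  odd4 : a ≡₈ a' → odd4 a ≈ᵇ odd4 a'

≈ᵇ-refl : ∀ {b} → b ≈ᵇ b
≈ᵇ-refl {hyp}    = hyp
≈ᵇ-refl {ell}    = ell
≈ᵇ-refl {odd2 a} = odd2 (≡₈-refl a)
≈ᵇ-refl {odd4 a} = odd4 (≡₈-refl a)

≈ᵇ⇒≅ : ∀ {b c} → b ≈ᵇ c → (b ∷ []) ≅ (c ∷ [])
≈ᵇ⇒≅ hyp = ≅-refl
≈ᵇ⇒≅ ell = ≅-refl
≈ᵇ⇒≅ (odd2 e) = record
  { to = λ x → x ; from = λ x → x ; from-to = λ _ → refl ; to-from = λ _ → refl
  ; to-add = λ _ _ → refl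
  ; to-q = λ (x , _) → ≡-mod8 (+-cong₈ (*-cong₈ (*-cong₈ (≡₈-refl 2) (≡₈-sym e)) (≡₈-refl (toℕ x * toℕ x))) (≡₈-refl 0)) }
≈ᵇ⇒≅ (odd4 e) = record
  { to = λ x → x ; from = λ x → x ; from-to = λ _ → refl ; to-from = λ _ → refl
  ; to-add = λ _ _ → refl
  ; to-q = λ (x , _) → ≡-mod8 (+-cong₈ (*-cong₈ (≡₈-sym e) (≡₈-refl (toℕ x * toℕ x))) (≡₈-refl 0)) }

Pointwise-≈ᵇ⇒≅ : Pointwise _≈ᵇ_ bs bs' → bs ≅ bs'
Pointwise-≈ᵇ⇒≅ []       = ≅-refl
Pointwise-≈ᵇ⇒≅ (e ∷ es) = ≅-∷ (≈ᵇ⇒≅ e) (Pointwise-≈ᵇ⇒≅ es)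

formOf-≅ : ∀ k l → Pointwise _≡₈_ as as' → Pointwise _≡₈_ cs cs' →
           formOf k l as cs ≅ formOf k l as' cs'
formOf-≅ k l eas ecs = Pointwise-≈ᵇ⇒≅
  (Pointwise.++⁺ˡ ≈ᵇ-refl (replicate k hyp) (Pointwise.++⁺ˡ ≈ᵇ-refl (replicate l ell)
    (++⁺ (map⁺ odd2 odd2 (Pointwise.map odd2 eas)) (map⁺ odd4 odd4 (Pointwise.map odd4 ecs)))))

embed : bs ⊆ bs' → Elt bs → Elt bs'
embed []         _        = tt
embed (c ∷ʳ p)   x        = zeroEl c , embed p x
embed (refl ∷ p) (x , xs) = x , embed p xs

Q-embed : (p : bs ⊆ bs') (x : Elt bs) → Q bs' (embed p x) ≡ Q bs x
Q-embed []         _        = refl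
Q-embed (c ∷ʳ p)   x        = cong₂ _+_ (qEl-zero c) (Q-embed p x)
Q-embed (refl ∷ p) (x , xs) = cong (_ +_) (Q-embed p xs)

embed-zero : (p : bs ⊆ bs') (x : Elt bs) → embed p x ≡ zeroE bs' → x ≡ zeroE bs
embed-zero []         _        _ = refl
embed-zero (c ∷ʳ p)   x        e = embed-zero p x (cong proj₂ e)
embed-zero (refl ∷ p) (x , xs) e = cong₂ _,_ (cong proj₁ e) (embed-zero p xs (cong proj₂ e))

-- The ambient form is explicit: Agda cannot recover it from a (reducible) type Anisotropic bs'.
Anisotropic-⊆ : ∀ bs' → bs ⊆ bs' → Anisotropic bs' → Anisotropic bs
Anisotropic-⊆ _ p an x x-isotropic =
  embed-zero p x (an (embed p x) (trans (cong (_% 8) (Q-embed p x)) x-isotropic))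

Searchable : Set → Set₁
Searchable A = ∀ {P : Pred A 0ℓ} → Decidable P → Dec (∀ x → P x)

searchable-× : ∀ {A B} → Searchable A → Searchable B → Searchable (A × B)
searchable-× search-A search-B P? =
  map′ uncurry curry (search-A λ x → search-B λ y → P? (x , y))

searchable-Vec : ∀ {A n} → Searchable A → Searchable (Vec A n)
searchable-Vec {n = zero}  _        P? = map′ (λ p → λ { [] → p }) (λ p → p []) (P? [])
searchable-Vec {n = suc n} search-A P? =
  map′ (λ p → λ { (x ∷ xs) → p x xs }) (λ p x xs → p (x ∷ xs))
       (search-A λ x → searchable-Vec search-A λ xs → P? (x ∷ xs))

searchable-El : ∀ b → Searchable (El b)
searchable-El hyp      = searchable-× all? all?
searchable-El ell      = searchable-× all? all?
searchable-El (odd2 a) = all?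
searchable-El (odd4 a) = all?

searchable-Elt : ∀ bs → Searchable (Elt bs)
searchable-Elt []       P? = map′ (λ p _ → p) (λ p → p tt) (P? tt)
searchable-Elt (b ∷ bs) = searchable-× (searchable-El b) (searchable-Elt bs)

_≟El_ : ∀ {b} → DecidableEquality (El b)
_≟El_ {hyp}    = ≡-dec _≟ᶠ_ _≟ᶠ_
_≟El_ {ell}    = ≡-dec _≟ᶠ_ _≟ᶠ_
_≟El_ {odd2 a} = _≟ᶠ_
_≟El_ {odd4 a} = _≟ᶠ_

_≟Elt_ : DecidableEquality (Elt bs)
_≟Elt_ {[]}     = _≟ᵘ_
_≟Elt_ {b ∷ bs} = ≡-dec _≟El_ _≟Elt_

anisotropic? : ∀ bs → Dec (Anisotropic bs)
anisotropic? bs = searchable-Elt bs λ x → Q bs x % 8 ≟ℕ 0 →-dec x ≟Elt zeroE bs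

residue : Fin 4 → ℕ
residue i = 1 + 2 * toℕ i

residues : ∀ {n} → Vec (Fin 4) n → List ℕ
residues is = toList (mapᵛ residue is)

odd-residue : ∀ (r : Fin 8) → toℕ r % 2 ≡ 1 → ∃ λ i → toℕ r ≡₈ residue i
odd-residue 1F _ = 0F , mod8 refl
odd-residue 3F _ = 1F , mod8 refl
odd-residue 5F _ = 2F , mod8 refl
odd-residue 7F _ = 3F , mod8 refl
odd-residue 0F ()
odd-residue 2F ()
odd-residue 4F ()
odd-residue 6F ()

odd⇒residue : Odd a → ∃ λ i → a ≡₈ residue i
odd⇒residue {a} odd = map₂ (≡₈-trans a≡r) (odd-residue r r-odd)
  where
  r : Fin 8
  r = a mod 8
  toℕ-r : toℕ r ≡ a % 8
  toℕ-r = toℕ-fromℕ< (m%n<n a 8)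
  a≡r : a ≡₈ toℕ r
  a≡r = mod8 (sym (trans (cong (_% 8) toℕ-r) (m%n%n≡m%n a 8)))
  r-odd : toℕ r % 2 ≡ 1
  r-odd = trans (cong (_% 2) toℕ-r) (trans (m∣n⇒o%n%m≡o%m 2 8 a (divides-refl 4)) odd)

odd⇒residues : All Odd as → ∃ λ (is : Vec (Fin 4) (length as)) → Pointwise _≡₈_ as (residues is)
odd⇒residues []           = [] , []
odd⇒residues (odd ∷ odds) with i , e ← odd⇒residue odd | is , es ← odd⇒residues odds =
  i ∷ is , e ∷ es

-- A property seeing the odd entries only mod 8 holds once it holds for the residues 1, 3, 5, 7;
-- the hidden argument of by-residues is discharged by running that finite check at the call site.
module ResidueSearch {P : List ℕ → List ℕ → Set} (P? : ∀ as cs → Dec (P as cs))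
  (P-resp : ∀ {as as' cs cs'} → Pointwise _≡₈_ as as' → Pointwise _≡₈_ cs cs' → P as' cs' → P as cs) where

  holds-on-residues? : ∀ n m → Dec (∀ (is : Vec (Fin 4) n) (js : Vec (Fin 4) m) → P (residues is) (residues js))
  holds-on-residues? n m = searchable-Vec all? λ is → searchable-Vec all? λ js → P? (residues is) (residues js)

  by-residues : ∀ as cs → All Odd as → All Odd cs → {True (holds-on-residues? (length as) (length cs))} → P as cs
  by-residues _ _ odds₁ odds₂ {found}
    with is , es ← odd⇒residues odds₁ | js , fs ← odd⇒residues odds₂ =
    P-resp es fs (toWitness found is js)

module Anisotropic-search (k l : ℕ) = ResidueSearch (λ as cs → anisotropic? (formOf k l as cs))
  (λ es fs → ≅⇒Anisotropic (formOf-≅ k l es fs))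

module Isotropic-search (k l : ℕ) = ResidueSearch (λ as cs → ¬? (anisotropic? (formOf k l as cs)))
  (λ es fs isotropic an → isotropic (≅⇒Anisotropic (≅-sym (formOf-≅ k l es fs)) an))

_⇔-dec_ : ∀ {A B : Set} → Dec A → Dec B → Dec (A ⇔ B)
a? ⇔-dec b? = map′ (uncurry mk⇔) (λ e → to e , from e) ((a? →-dec b?) ×-dec (b? →-dec a?))

module Anisotropy-criterion (k l : ℕ) {A : Set} (_≟_ : DecidableEquality A)
  (inv : List ℕ → A) (v : A) (inv-cong : ∀ {as as'} → Pointwise _≡₈_ as as' → inv as ≡ inv as') =
  ResidueSearch (λ as cs → anisotropic? (formOf k l as cs) ⇔-dec (inv as ≟ v))
    (λ es fs h → ⇔-trans (≅⇒Anisotropic⇔ (formOf-≅ k l es fs))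
                   (⇔-trans h (mk⇔ (trans (inv-cong es)) (trans (sym (inv-cong es))))))

anisotropic-2²⇔ : ∀ a₁ a₂ → Odd a₁ → Odd a₂ →
                  Anisotropic (formOf 0 0 (a₁ ∷ a₂ ∷ []) []) ⇔ (a₁ + a₂) % 4 ≡ 2
anisotropic-2²⇔ a₁ a₂ o₁ o₂ =
  subst (λ t → Anisotropic (formOf 0 0 (a₁ ∷ a₂ ∷ []) []) ⇔ t % 4 ≡ 2)
        (cong (a₁ +_) (+-identityʳ a₂))
    (Criterion.by-residues (a₁ ∷ a₂ ∷ []) [] (o₁ ∷ o₂ ∷ []) [])
  where
  module Criterion = Anisotropy-criterion 0 0 _≟ℕ_ (λ as → sum as % 4) 2
    (λ es → ≡₈⇒≡₄ (sum-cong₈ es))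

anisotropic-2³⇔ : ∀ a₁ a₂ a₃ → Odd a₁ → Odd a₂ → Odd a₃ →
                  Anisotropic (formOf 0 0 (a₁ ∷ a₂ ∷ a₃ ∷ []) []) ⇔
                  signProd (a₁ ∷ a₂ ∷ a₃ ∷ []) *ₛ kron (a₁ + a₂ + a₃) ≡ Sign.-
anisotropic-2³⇔ a₁ a₂ a₃ o₁ o₂ o₃ =
  subst (λ t → Anisotropic (formOf 0 0 (a₁ ∷ a₂ ∷ a₃ ∷ []) []) ⇔ signProd (a₁ ∷ a₂ ∷ a₃ ∷ []) *ₛ kron t ≡ Sign.-)
        sum-[a₁,a₂,a₃]
    (Criterion.by-residues (a₁ ∷ a₂ ∷ a₃ ∷ []) [] (o₁ ∷ o₂ ∷ o₃ ∷ []) [])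
  where
  module Criterion = Anisotropy-criterion 0 0 _≟ˢ_ (λ as → signProd as *ₛ kron (sum as)) Sign.-
    (λ es → cong₂ _*ₛ_ (signProd-cong es) (kron-cong (sum-cong₈ es)))
  sum-[a₁,a₂,a₃] : sum (a₁ ∷ a₂ ∷ a₃ ∷ []) ≡ a₁ + a₂ + a₃
  sum-[a₁,a₂,a₃] = trans (cong (λ t → a₁ + (a₂ + t)) (+-identityʳ a₃)) (sym (+-assoc a₁ a₂ a₃))

IsIso : ∀ bs bs' → (Elt bs → Elt bs') → (Elt bs' → Elt bs) → Set
IsIso bs bs' f g = (∀ x → g (f x) ≡ x) × (∀ y → f (g y) ≡ y)
                 × (∀ x y → f (add bs x y) ≡ add bs' (f x) (f y)) × (∀ x → Q bs' (f x) % 8 ≡ Q bs x % 8)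

isIso? : ∀ bs bs' f g → Dec (IsIso bs bs' f g)
isIso? bs bs' f g =
  searchable-Elt bs (λ x → g (f x) ≟Elt x) ×-dec searchable-Elt bs' (λ y → f (g y) ≟Elt y)
  ×-dec searchable-Elt bs (λ x → searchable-Elt bs λ y → f (add bs x y) ≟Elt add bs' (f x) (f y))
  ×-dec searchable-Elt bs (λ x → Q bs' (f x) % 8 ≟ℕ Q bs x % 8)

IsIso⇒≅ : ∀ f g → IsIso bs bs' f g → bs ≅ bs'
IsIso⇒≅ f g (g∘f , f∘g , f-add , f-q) = record
  { to = f ; from = g ; from-to = g∘f ; to-from = f∘g ; to-add = f-add ; to-q = f-q }

ell⊕2→2³ : (Fin 2 × Fin 2) × Fin 2 × ⊤ → Fin 2 × Fin 2 × Fin 2 × ⊤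
ell⊕2→2³ ((x , y) , z , tt) = addF 1 x z , addF 1 y z , addF 1 (addF 1 x y) z , tt

2³→ell⊕2 : Fin 2 × Fin 2 × Fin 2 × ⊤ → (Fin 2 × Fin 2) × Fin 2 × ⊤
2³→ell⊕2 (u , v , w , tt) = (addF 1 u s , addF 1 v s) , s , tt
  where s = addF 1 (addF 1 u v) w

-- The oddity of 2_II^{-2} 2_a is a and that of 2_b^3 is 3b, whence b ≡ 3a (mod 8).
ell⊕2≅2³ : ∀ a → Odd a → formOf 0 1 (a ∷ []) [] ≅ formOf 0 0 (3 * a ∷ 3 * a ∷ 3 * a ∷ []) []
ell⊕2≅2³ a odd with i , a≡i ← odd⇒residue odd =
  ≅-trans (formOf-≅ 0 1 (a≡i ∷ []) []) (≅-trans (on-residues i) (formOf-≅ 0 0 (e ∷ e ∷ e ∷ []) []))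
  where
  on-residues : ∀ i → formOf 0 1 (residue i ∷ []) [] ≅
                      formOf 0 0 (3 * residue i ∷ 3 * residue i ∷ 3 * residue i ∷ []) []
  on-residues i = IsIso⇒≅ ell⊕2→2³ 2³→ell⊕2
    (toWitness {a? = all? λ i → isIso? (formOf 0 1 (residue i ∷ []) [])
                                       (formOf 0 0 (3 * residue i ∷ 3 * residue i ∷ 3 * residue i ∷ []) [])
                                       ell⊕2→2³ 2³→ell⊕2} _ i)
  e : 3 * residue i ≡₈ 3 * a
  e = *-cong₈ (≡₈-refl 3) (≡₈-sym a≡i)

Listed⇒Anisotropic : Listed bs → Anisotropic bs
Listed⇒Anisotropic trivial                       = Anisotropic-search.by-residues 0 0 [] [] [] []
Listed⇒Anisotropic evenMinus                     = Anisotropic-search.by-residues 0 1 [] [] [] []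
Listed⇒Anisotropic (two1 a oa)                   = Anisotropic-search.by-residues 0 0 (a ∷ []) [] (oa ∷ []) []
Listed⇒Anisotropic (two2 a₁ a₂ o₁ o₂ t≡2)        = from (anisotropic-2²⇔ a₁ a₂ o₁ o₂) t≡2
Listed⇒Anisotropic (two3 a₁ a₂ a₃ o₁ o₂ o₃ ε≡-)  = from (anisotropic-2³⇔ a₁ a₂ a₃ o₁ o₂ o₃) ε≡-
Listed⇒Anisotropic (four1 c oc)                  = Anisotropic-search.by-residues 0 0 [] (c ∷ []) [] (oc ∷ [])
Listed⇒Anisotropic (two1four1 a c oa oc)         =
  Anisotropic-search.by-residues 0 0 (a ∷ []) (c ∷ []) (oa ∷ []) (oc ∷ [])

Listed⇒InList : Listed bs → InList bs
Listed⇒InList {bs} listed = bs , listed , ≅-refl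

classify-2ⁿ : ∀ as → All Odd as → Anisotropic (formOf 0 0 as []) → InList (formOf 0 0 as [])
classify-2ⁿ []                  []                  _  = Listed⇒InList trivial
classify-2ⁿ (a ∷ [])            (oa ∷ [])           _  = Listed⇒InList (two1 a oa)
classify-2ⁿ (a₁ ∷ a₂ ∷ [])      (o₁ ∷ o₂ ∷ [])      an =
  Listed⇒InList (two2 a₁ a₂ o₁ o₂ (to (anisotropic-2²⇔ a₁ a₂ o₁ o₂) an))
classify-2ⁿ (a₁ ∷ a₂ ∷ a₃ ∷ []) (o₁ ∷ o₂ ∷ o₃ ∷ []) an =
  Listed⇒InList (two3 a₁ a₂ a₃ o₁ o₂ o₃ (to (anisotropic-2³⇔ a₁ a₂ a₃ o₁ o₂ o₃) an))
classify-2ⁿ (a₁ ∷ a₂ ∷ a₃ ∷ a₄ ∷ as) (o₁ ∷ o₂ ∷ o₃ ∷ o₄ ∷ _) an = ⊥-elim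
  (Isotropic-search.by-residues 0 0 (a₁ ∷ a₂ ∷ a₃ ∷ a₄ ∷ []) [] (o₁ ∷ o₂ ∷ o₃ ∷ o₄ ∷ []) []
    (Anisotropic-⊆ (formOf 0 0 (a₁ ∷ a₂ ∷ a₃ ∷ a₄ ∷ as) []) (refl ∷ refl ∷ refl ∷ refl ∷ minimum _) an))

classify-odd : ∀ as cs → All Odd as → All Odd cs → Anisotropic (formOf 0 0 as cs) → InList (formOf 0 0 as cs)
classify-odd as        []            odds      []         an = classify-2ⁿ as odds an
classify-odd []        (c ∷ [])      []        (oc ∷ [])  _  = Listed⇒InList (four1 c oc)
classify-odd (a ∷ [])  (c ∷ [])      (oa ∷ []) (oc ∷ [])  _  = Listed⇒InList (two1four1 a c oa oc)
classify-odd (a₁ ∷ a₂ ∷ as) (c ∷ []) (o₁ ∷ o₂ ∷ _) (oc ∷ []) an = ⊥-elim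
  (Isotropic-search.by-residues 0 0 (a₁ ∷ a₂ ∷ []) (c ∷ []) (o₁ ∷ o₂ ∷ []) (oc ∷ [])
    (Anisotropic-⊆ (formOf 0 0 (a₁ ∷ a₂ ∷ as) (c ∷ [])) (refl ∷ refl ∷ ++⁺ˡ (map odd2 as) (refl ∷ [])) an))
classify-odd as (c₁ ∷ c₂ ∷ cs) _ (o₁ ∷ o₂ ∷ _) an = ⊥-elim
  (Isotropic-search.by-residues 0 0 [] (c₁ ∷ c₂ ∷ []) [] (o₁ ∷ o₂ ∷ [])
    (Anisotropic-⊆ (formOf 0 0 as (c₁ ∷ c₂ ∷ cs)) (++⁺ˡ (map odd2 as) (refl ∷ refl ∷ minimum _)) an))

classify-ell : ∀ as cs → All Odd as → All Odd cs → Anisotropic (formOf 0 1 as cs) → InList (formOf 0 1 as cs)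
classify-ell []       []  _         _ _  = Listed⇒InList evenMinus
classify-ell (a ∷ []) []  (oa ∷ []) _ an =
  _ , two3 _ _ _ o₃ₐ o₃ₐ o₃ₐ (to (anisotropic-2³⇔ (3 * a) (3 * a) (3 * a) o₃ₐ o₃ₐ o₃ₐ) an′) , ell⊕2≅2³ a oa
  where
  an′ : Anisotropic (formOf 0 0 (3 * a ∷ 3 * a ∷ 3 * a ∷ []) [])
  an′ = ≅⇒Anisotropic (≅-sym (ell⊕2≅2³ a oa)) an
  o₃ₐ : Odd (3 * a)
  o₃ₐ = *-odd 3 a refl oa
classify-ell (a₁ ∷ a₂ ∷ as) cs (o₁ ∷ o₂ ∷ _) _ an = ⊥-elim
  (Isotropic-search.by-residues 0 1 (a₁ ∷ a₂ ∷ []) [] (o₁ ∷ o₂ ∷ []) []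
    (Anisotropic-⊆ (formOf 0 1 (a₁ ∷ a₂ ∷ as) cs) (refl ∷ refl ∷ refl ∷ minimum _) an))
classify-ell as (c ∷ cs) _ (oc ∷ _) an = ⊥-elim
  (Isotropic-search.by-residues 0 1 [] (c ∷ []) [] (oc ∷ [])
    (Anisotropic-⊆ (formOf 0 1 as (c ∷ cs)) (refl ∷ ++⁺ˡ (map odd2 as) (refl ∷ minimum _)) an))

classify : ∀ k l as cs → All Odd as → All Odd cs → Anisotropic (formOf k l as cs) → InList (formOf k l as cs)
classify (suc k) l as cs _ _ an = ⊥-elim
  (Isotropic-search.by-residues 1 0 [] [] [] [] (Anisotropic-⊆ (formOf (suc k) l as cs) (refl ∷ minimum _) an))
classify 0 (suc (suc l)) as cs _ _ an = ⊥-elim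
  (Isotropic-search.by-residues 0 2 [] [] [] [] (Anisotropic-⊆ (formOf 0 (2 + l) as cs) (refl ∷ refl ∷ minimum _) an))
classify 0 1 as cs = classify-ell as cs
classify 0 0 as cs = classify-odd as cs

mainTheorem17 : (k l : ℕ) (as cs : List ℕ) → All Odd as → All Odd cs →
                  (Anisotropic (formOf k l as cs) → InList (formOf k l as cs))
                  × (InList (formOf k l as cs) → Anisotropic (formOf k l as cs))
mainTheorem17 k l as cs odds₁ odds₂ =
  classify k l as cs odds₁ odds₂ ,
  λ (_ , listed , iso) → ≅⇒Anisotropic iso (Listed⇒Anisotropic listed)
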